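{- For $n\ge 4$, $\chi_{CF}(\mathsf{FC}_3(n))=2$. For odd $d\ge 5$ and $n\ge d+1$, $\chi_{CF}(\mathsf{FC}_d(n))=3$.
   Context: A conflict-free coloring (CF-coloring) of a hypergraph $(V,\mathcal{E})$ is a map $\varphi$ on $V$ such that every nonempty hyperedge $e$ contains a vertex $x$ with $\varphi(y)\ne\varphi(x)$ for all $y\in e\setminus\{x\}$; $\chi_{CF}(H)$ is the least number of colors in a CF-coloring of $H$. For $n\ge d+1$, $\mathsf{C}_d(n)$ is the convex hull of $\gamma_d(1),\dots,\gamma_d(n)$ where $\gamma_d(t)=(t,t^2,\dots,t^d)$, and we identify $\gamma_d(i)$ with $i\in[n]$. $\mathsf{FC}_d(n)$ is the $d$-uniform hypergraph on $[n]$ whose hyperedges are the vertex sets of facets of $\mathsf{C}_d(n)$. Equivalently (Gale's evenness criterion), a $d$-subset $S\subseteq[n]$ is a hyperedge iff for all $i,j\in[n]\setminus S$ the set $\{k\in S: i<k<j\}$ has even size. -}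

module Defs where

open import Data.Nat using (ℕ; _<_)
open import Data.Nat.Divisibility using (_∣_)
open import Data.Fin using (Fin) renaming (_<?_ to _<ᶠ?_)
open import Data.Fin.Subset using (Subset; _∈_; _∉_; _∩_; ∣_∣)
open import Data.Vec using (tabulate)
open import Data.Bool using (_∧_)
open import Data.Product using (∃; _×_)
open import Relation.Nullary using (¬_)
open import Relation.Nullary.Decidable using (⌊_⌋)
open import Relation.Binary.PropositionalEquality using (_≡_; _≢_)

Hypergraph : ℕ → Set₁
Hypergraph n = Subset n → Set

IsCFColoring : ∀ {n} → Hypergraph n → (c : ℕ) → (Fin n → Fin c) → Set
IsCFColoring {n} H c φ =
  ∀ (e : Subset n) → H e → (∃ λ (v : Fin n) → v ∈ e) →
  ∃ λ (x : Fin n) → x ∈ e × (∀ (y : Fin n) → y ∈ e → y ≢ x → φ y ≢ φ x)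

χCF≡ : ∀ {n} → Hypergraph n → ℕ → Set
χCF≡ H k =
  (∃ λ φ → IsCFColoring H k φ) ×
  (∀ m → m < k → ¬ (∃ λ φ → IsCFColoring H m φ))

between : ∀ {n} → Fin n → Fin n → Subset n
between i j = tabulate (λ k → ⌊ i <ᶠ? k ⌋ ∧ ⌊ k <ᶠ? j ⌋)

-- Facet hypergraph of the cyclic polytope C_d(n), via Gale's evenness
-- criterion.  Vertex i ∈ [n] is represented by the element (i-1) of Fin n
-- (an order-preserving relabelling).
FC : (d n : ℕ) → Hypergraph n
FC d n S =
  (∣ S ∣ ≡ d) ×
  (∀ (i j : Fin n) → i ∉ S → j ∉ S → 2 ∣ ∣ S ∩ between i j ∣)

-- By Gale's criterion a facet of C_d(n) is a d-set S such that an even number of vertices of S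
-- lies between any two non-vertices; the vertices are numbered 0, …, n − 1.
--
-- For odd d every facet contains the first or the last vertex, since otherwise all
-- d of its vertices lie between these two non-vertices.  Hence giving the first vertex, the last
-- vertex and the interior three different colors is conflict-free.  For d = 3 two colors (ends
-- against interior) suffice: a facet with only one end uses that end, and a facet with both ends
-- has exactly one interior vertex.
--
-- Put p = n − d.  The sets whose non-vertices form one block [b, b + p) are facets;
-- for b = d this is {0, …, d − 1}, so one color does not suffice.  For two colors and a + 2 < d,
-- let D be the facet with block [a + 2, a + 2 + p), minus the vertex a.  Then D ∪ {a} is that
-- facet and D ∪ {a + 2} is a facet too: its non-vertices a and [a + 3, a + 2 + p) are separated by
-- the two vertices a + 1 and a + 2.  If a and a + 2 had different colors, the uniquely colored
-- vertices of these two facets would cover D, which has d − 1 ≥ 3 elements.  So the coloring has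
-- period 2 on {0, …, d − 1}, and then no vertex of that facet is uniquely colored.
module Submission where

open import Data.Bool using (Bool; true; false; _∧_; _∨_; if_then_else_)
open import Data.Bool.Properties using (∧-zeroʳ; ∧-identityʳ; ∨-zeroʳ)
open import Data.Empty using (⊥; ⊥-elim)
open import Data.Fin using (Fin; toℕ; fromℕ<; fromℕ; #_) renaming (_≟_ to _≟ᶠ_)
import Data.Fin as Fin
open import Data.Fin.Properties using (any?; toℕ<n; toℕ-fromℕ<; fromℕ<-toℕ; toℕ-fromℕ; toℕ-injective)
open import Data.Fin.Subset using (Subset; _∈_; _∉_; _⊆_; _∩_; _∪_; _-_; ∣_∣; ⁅_⁆; inside; outside)
open import Data.Fin.Subset.Properties
  using ( _∈?_; ⊆-antisym; p∩q⊆p; x∈p∩q⁺; x∈p∪q⁺; x∈⁅x⁆; x∈p∧x≢y⇒x∈p-y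
        ; p⊆q⇒∣p∣≤∣q∣; ∣⁅x⁆∣≡1; x∈p⇒∣p-x∣<∣p∣)
open import Data.Nat using (ℕ; zero; suc; _+_; _∸_; _≤_; _<_; z≤n; s≤s; s≤s⁻¹; z<s; s<s; _<?_; _≤?_; _≟_)
open import Data.Nat.Divisibility using (_∣_; _∣0; ∣-refl; _∣?_)
open import Data.Nat.Properties
open import Algebra.Properties.CommutativeSemigroup +-commutativeSemigroup using (interchange; xy∙z≈xz∙y)
open import Data.Product using (_×_; _,_; ∃; proj₁; proj₂)
open import Data.Sum using (_⊎_; inj₁; inj₂; [_,_]′)
open import Data.Vec using (tabulate; []; _∷_)
open import Data.Vec.Properties using (lookup∘tabulate; lookup⇒[]=; []=⇒lookup)
open import Function using (_∘_)
open import Relation.Binary.Definitions using (tri<; tri≈; tri>)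
open import Relation.Binary.PropositionalEquality
open import Relation.Nullary using (¬_; Dec; yes; no; contradiction)
open import Relation.Nullary.Decidable
  using (⌊_⌋; isYes≗does; dec-true; dec-false; ¬?; _×-dec_; decidable-stable; from-no)

open import Defs

private variable
  A : Set
  a b d i j k m n p u v x y : ℕ
  P Q R D e e₁ e₂ : ℕ → Bool

⌊⌋-true : (a? : Dec A) → A → ⌊ a? ⌋ ≡ true
⌊⌋-true a? a = trans (isYes≗does a?) (dec-true a? a)

⌊⌋-false : (a? : Dec A) → ¬ A → ⌊ a? ⌋ ≡ false
⌊⌋-false a? ¬a = trans (isYes≗does a?) (dec-false a? ¬a)

-- Counting Boolean predicates on ℕ

bit : Bool → ℕ
bit true  = 1
bit false = 0

count : ℕ → (ℕ → Bool) → ℕ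
count zero    P = 0
count (suc n) P = bit (P 0) + count n (P ∘ suc)

count-cong : (∀ {k} → k < n → P k ≡ Q k) → count n P ≡ count n Q
count-cong {zero}  P≗Q = refl
count-cong {suc n} P≗Q = cong₂ _+_ (cong bit (P≗Q z<s)) (count-cong (P≗Q ∘ s<s))

count-+ : ∀ m l → count (m + l) P ≡ count m P + count l (P ∘ (m +_))
count-+         zero    l = refl
count-+ {P = P} (suc m) l rewrite count-+ {P = P ∘ suc} m l = sym (+-assoc (bit (P 0)) _ _)

count-all : (∀ {k} → k < n → P k ≡ true) → count n P ≡ n
count-all {zero}  all = refl
count-all {suc n} all rewrite all z<s = cong suc (count-all (all ∘ s<s))

count-none : (∀ {k} → k < n → P k ≡ false) → count n P ≡ 0
count-none {zero}  none = refl
count-none {suc n} none rewrite none z<s = count-none (none ∘ s<s)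

count-mono : (∀ {k} → k < n → P k ≡ true → Q k ≡ true) → count n P ≤ count n Q
count-mono {zero}          P⇒Q = z≤n
count-mono {suc n} {P} {Q} P⇒Q = +-mono-≤ (bit-mono (P 0) (P⇒Q z<s)) (count-mono (P⇒Q ∘ s<s))
  where
  bit-mono : ∀ a {b} → (a ≡ true → b ≡ true) → bit a ≤ bit b
  bit-mono false a⇒b = z≤n
  bit-mono true  a⇒b rewrite a⇒b refl = ≤-refl

count-add : (∀ {k} → k < n → bit (P k) + bit (Q k) ≡ bit (R k)) → count n P + count n Q ≡ count n R
count-add {zero}          sum = refl
count-add {suc n} {P} {Q} sum =
  trans (interchange (bit (P 0)) (count n (P ∘ suc)) (bit (Q 0)) (count n (Q ∘ suc)))
        (cong₂ _+_ (sum z<s) (count-add (sum ∘ s<s)))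

count-∨ : count n (λ k → P k ∨ Q k) ≤ count n P + count n Q
count-∨ {zero}          = z≤n
count-∨ {suc n} {P} {Q} = begin
  bit (P 0 ∨ Q 0) + count n (λ k → P (suc k) ∨ Q (suc k))
    ≤⟨ +-mono-≤ (bit-∨ (P 0) (Q 0)) (count-∨ {n}) ⟩
  (bit (P 0) + bit (Q 0)) + (count n (P ∘ suc) + count n (Q ∘ suc))
    ≡⟨ interchange (bit (P 0)) (count n (P ∘ suc)) (bit (Q 0)) (count n (Q ∘ suc)) ⟨
  count (suc n) P + count (suc n) Q
    ∎
  where
  open ≤-Reasoning
  bit-∨ : ∀ a b → bit (a ∨ b) ≤ bit a + bit b
  bit-∨ false b = ≤-refl
  bit-∨ true  b = s≤s z≤n

count-below : m ≤ n → count n (λ k → P k ∧ ⌊ k <? m ⌋) ≡ count m P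
count-below {m} {n} {P} m≤n = begin
  count n P<m                                  ≡⟨ cong (λ n → count n P<m) (m+[n∸m]≡n m≤n) ⟨
  count (m + (n ∸ m)) P<m                      ≡⟨ count-+ m (n ∸ m) ⟩
  count m P<m + count (n ∸ m) (P<m ∘ (m +_))   ≡⟨ cong₂ _+_ (count-cong below) (count-none above) ⟩
  count m P + 0                                ≡⟨ +-identityʳ (count m P) ⟩
  count m P                                    ∎
  where
  open ≡-Reasoning
  P<m : ℕ → Bool
  P<m k = P k ∧ ⌊ k <? m ⌋
  below : k < m → P<m k ≡ P k
  below {k} k<m rewrite ⌊⌋-true (k <? m) k<m = ∧-identityʳ (P k)
  above : k < n ∸ m → P<m (m + k) ≡ false
  above {k} _ rewrite ⌊⌋-false (m + k <? m) (m+n≮m m k) = ∧-zeroʳ (P (m + k))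

Adjoins : (ℕ → Bool) → (ℕ → Bool) → ℕ → Set
Adjoins e D u = D u ≡ false × e u ≡ true × (∀ {k} → k ≢ u → e k ≡ D k)

adjoin-∉ : Adjoins e D u → D k ≡ true → k ≢ u
adjoin-∉ (Du≡f , _ , _) Dk≡t refl = contradiction (trans (sym Du≡f) Dk≡t) λ ()

adjoin-⊇ : Adjoins e D u → D k ≡ true → e k ≡ true
adjoin-⊇ adj@(_ , _ , e≗D) Dk≡t = trans (e≗D (adjoin-∉ adj Dk≡t)) Dk≡t

adjoin-⊆ : Adjoins e D u → e k ≡ true → k ≢ u → D k ≡ true
adjoin-⊆ (_ , _ , e≗D) ek≡t k≢u = trans (sym (e≗D k≢u)) ek≡t

count-adjoin : u < n → Adjoins e D u → count n e ≡ suc (count n D)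
count-adjoin {zero}  {suc n} {e} {D} _ (Du≡f , eu≡t , e≗D) rewrite Du≡f | eu≡t =
  cong suc (count-cong {n} λ {k} _ → e≗D {suc k} λ ())
count-adjoin {suc u} {suc n} {e} {D} (s<s u<n) (Du≡f , eu≡t , e≗D) rewrite e≗D {0} (λ ()) =
  trans (cong (bit (D 0) +_) (count-adjoin u<n (Du≡f , eu≡t , e≗D ∘ (_∘ suc-injective))))
        (+-suc (bit (D 0)) (count n (D ∘ suc)))

count-point : x < n → count n (λ k → ⌊ k ≟ x ⌋) ≡ 1
count-point {x} {n} x<n =
  trans (count-adjoin {D = λ _ → false} x<n (refl , ⌊⌋-true (x ≟ x) refl , λ {k} → ⌊⌋-false (k ≟ x)))
        (cong suc (count-none {n} λ _ → refl))

count-pair : x < n → y < n → (∀ {k} → k < n → P k ≡ true → k ≡ x ⊎ k ≡ y) → count n P ≤ 2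
count-pair {x} {n} {y} {P} x<n y<n pair = begin
  count n P                                              ≤⟨ count-mono (λ k<n Pk → atPair (pair k<n Pk)) ⟩
  count n (λ k → ⌊ k ≟ x ⌋ ∨ ⌊ k ≟ y ⌋)                  ≤⟨ count-∨ {n} ⟩
  count n (λ k → ⌊ k ≟ x ⌋) + count n (λ k → ⌊ k ≟ y ⌋)
                                                         ≡⟨ cong₂ _+_ (count-point x<n) (count-point y<n) ⟩
  2                                                      ∎
  where
  open ≤-Reasoning
  atPair : k ≡ x ⊎ k ≡ y → ⌊ k ≟ x ⌋ ∨ ⌊ k ≟ y ⌋ ≡ true
  atPair {k} (inj₁ k≡x) rewrite ⌊⌋-true (k ≟ x) k≡x = refl
  atPair {k} (inj₂ k≡y) rewrite ⌊⌋-true (k ≟ y) k≡y = ∨-zeroʳ _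

update : (ℕ → Bool) → ℕ → Bool → ℕ → Bool
update P u b k = if ⌊ k ≟ u ⌋ then b else P k

update-≢ : ∀ {b} → k ≢ u → update P u b k ≡ P k
update-≢ {k} {u} k≢u rewrite ⌊⌋-false (k ≟ u) k≢u = refl

update-≡ : ∀ {b} → update P u b u ≡ b
update-≡ {u = u} rewrite ⌊⌋-true (u ≟ u) refl = refl

update-adjoins : P u ≡ false → Adjoins (update P u true) P u
update-adjoins {P} Pu≡f = Pu≡f , update-≡ {P} , update-≢ {P = P}

adjoins-update : P u ≡ true → Adjoins P (update P u false) u
adjoins-update {P} Pu≡t = update-≡ {P} , Pu≡t , sym ∘ update-≢ {P = P}

-- Gale's criterion through prefix counts

Between : ℕ → ℕ → ℕ → Bool
Between i j k = ⌊ i <? k ⌋ ∧ ⌊ k <? j ⌋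

count-Between : i < j → j ≤ n → P i ≡ false → count n (λ k → P k ∧ Between i j k) + count i P ≡ count j P
count-Between {i} {j} {n} {P} i<j j≤n Pi≡f = begin
  count n (λ k → P k ∧ Between i j k) + count i P
    ≡⟨ cong (count n (λ k → P k ∧ Between i j k) +_) (count-below (≤-trans (<⇒≤ i<j) j≤n)) ⟨
  count n (λ k → P k ∧ Between i j k) + count n (λ k → P k ∧ ⌊ k <? i ⌋)
    ≡⟨ count-add split ⟩
  count n (λ k → P k ∧ ⌊ k <? j ⌋)
    ≡⟨ count-below j≤n ⟩
  count j P
    ∎
  where
  open ≡-Reasoning
  split : k < n → bit (P k ∧ Between i j k) + bit (P k ∧ ⌊ k <? i ⌋) ≡ bit (P k ∧ ⌊ k <? j ⌋)
  split {k} _ with <-cmp k i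
  ... | tri≈ _ refl _ rewrite Pi≡f = refl
  ... | tri< k<i _ _
    rewrite ⌊⌋-false (i <? k) (<-asym k<i) | ⌊⌋-true (k <? i) k<i | ⌊⌋-true (k <? j) (<-trans k<i i<j)
    = cong (λ b → bit b + bit (P k ∧ true)) (∧-zeroʳ (P k))
  ... | tri> _ _ i<k
    rewrite ⌊⌋-true (i <? k) i<k | ⌊⌋-false (k <? i) (<-asym i<k) | ∧-zeroʳ (P k)
    = +-identityʳ _

count-Between-empty : j ≤ i → count n (λ k → P k ∧ Between i j k) ≡ 0
count-Between-empty {j} {i} {n} {P} j≤i = count-none empty
  where
  empty : k < n → P k ∧ Between i j k ≡ false
  empty {k} _ with i <? k
  ... | no  _   = ∧-zeroʳ (P k)
  ... | yes i<k rewrite ⌊⌋-false (k <? j) (<-asym (≤-<-trans j≤i i<k)) = ∧-zeroʳ (P k)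

∈-tabulate⁺ : ∀ {n} {f : Fin n → Bool} {x} → f x ≡ true → x ∈ tabulate f
∈-tabulate⁺ {f = f} {x} fx≡t = lookup⇒[]= x _ (trans (lookup∘tabulate f x) fx≡t)

∈-tabulate⁻ : ∀ {n} {f : Fin n → Bool} {x} → x ∈ tabulate f → f x ≡ true
∈-tabulate⁻ {f = f} {x} x∈ = trans (sym (lookup∘tabulate f x)) ([]=⇒lookup x∈)

∩-tabulate : ∀ {n} (f g : Fin n → Bool) → tabulate f ∩ tabulate g ≡ tabulate (λ x → f x ∧ g x)
∩-tabulate {zero}  f g = refl
∩-tabulate {suc n} f g = cong (f Fin.zero ∧ g Fin.zero ∷_) (∩-tabulate (f ∘ Fin.suc) (g ∘ Fin.suc))

⟦_⟧ : ∀ {n} → (ℕ → Bool) → Subset n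
⟦ P ⟧ = tabulate (P ∘ toℕ)

∣⟦⟧∣ : ∀ n P → ∣ ⟦_⟧ {n} P ∣ ≡ count n P
∣⟦⟧∣ zero    P = refl
∣⟦⟧∣ (suc n) P with P 0
... | true  = cong suc (∣⟦⟧∣ n (P ∘ suc))
... | false = ∣⟦⟧∣ n (P ∘ suc)

∉⟦⟧ : ∀ {n} {x : Fin n} → x ∉ ⟦ P ⟧ → P (toℕ x) ≡ false
∉⟦⟧ {P} {x = x} x∉ with P (toℕ x) in Px
... | true  = contradiction (∈-tabulate⁺ Px) x∉
... | false = refl

∣⟦⟧∩between∣ : ∀ {n} P (i j : Fin n) →
               ∣ ⟦ P ⟧ ∩ between i j ∣ ≡ count n (λ k → P k ∧ Between (toℕ i) (toℕ j) k)
∣⟦⟧∩between∣ {n} P i j =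
  trans (cong (∣_∣ {n}) (∩-tabulate (P ∘ toℕ) (λ k → Between (toℕ i) (toℕ j) (toℕ k))))
        (∣⟦⟧∣ n (λ k → P k ∧ Between (toℕ i) (toℕ j) k))

-- For a non-vertex i < j, count j P ∸ count i P is the number of vertices strictly between i and j.
prefixCounts⇒FC : count n P ≡ d →
  (∀ {i j} → i < j → j < n → P i ≡ false → P j ≡ false → 2 ∣ count j P ∸ count i P) →
  FC d n ⟦ P ⟧
prefixCounts⇒FC {n} {P} card even = trans (∣⟦⟧∣ n P) card , gale
  where
  gale : ∀ (i j : Fin n) → i ∉ ⟦ P ⟧ → j ∉ ⟦ P ⟧ → 2 ∣ ∣ ⟦ P ⟧ ∩ between i j ∣
  gale i j i∉ j∉ rewrite ∣⟦⟧∩between∣ P i j with toℕ i <? toℕ j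
  ... | no  i≮j rewrite count-Between-empty {n = n} {P} (≮⇒≥ i≮j) = 2 ∣0
  ... | yes i<j = subst (2 ∣_) between≡ (even i<j (toℕ<n j) (∉⟦⟧ {P} i∉) (∉⟦⟧ {P} j∉))
    where
    inBetween : ℕ
    inBetween = count n (λ k → P k ∧ Between (toℕ i) (toℕ j) k)
    between≡ : count (toℕ j) P ∸ count (toℕ i) P ≡ inBetween
    between≡ = trans (cong (_∸ count (toℕ i) P)
                           (sym (count-Between {n = n} {P} i<j (<⇒≤ (toℕ<n j)) (∉⟦⟧ {P} i∉))))
                     (m+n∸n≡m inBetween (count (toℕ i) P))

-- Facets with a block of non-vertices

Outside : ℕ → ℕ → ℕ → Bool
Outside b p k = ⌊ k <? b ⌋ ∨ ⌊ b + p ≤? k ⌋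

Outside-< : k < b → Outside b p k ≡ true
Outside-< {k} {b} k<b rewrite ⌊⌋-true (k <? b) k<b = refl

Outside-≥ : b + p ≤ k → Outside b p k ≡ true
Outside-≥ {b} {p} {k} b+p≤k rewrite ⌊⌋-true (b + p ≤? k) b+p≤k = ∨-zeroʳ _

Outside-block : b ≤ k → k < b + p → Outside b p k ≡ false
Outside-block {b} {k} {p} b≤k k<b+p
  rewrite ⌊⌋-false (k <? b) (≤⇒≯ b≤k) | ⌊⌋-false (b + p ≤? k) (<⇒≱ k<b+p) = refl

Outside-false : Outside b p k ≡ false → b ≤ k × k < b + p
Outside-false {b} {p} {k} k∉ with k <? b | b + p ≤? k
... | no k≮b | no b+p≰k = ≮⇒≥ k≮b , ≰⇒> b+p≰k
... | yes _  | _        = contradiction k∉ λ ()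
... | no _   | yes _    = contradiction k∉ λ ()

Outside-true : Outside b p k ≡ true → k < b + p → k < b
Outside-true k∈ k<b+p = ≰⇒> λ b≤k → contradiction (trans (sym k∈) (Outside-block b≤k k<b+p)) λ ()

count-Outside-≤ : i ≤ b → count i (Outside b p) ≡ i
count-Outside-≤ i≤b = count-all λ k<i → Outside-< (<-≤-trans k<i i≤b)

count-Outside-block : b ≤ i → i ≤ b + p → count i (Outside b p) ≡ b
count-Outside-block {b} {i} {p} b≤i i≤b+p = begin
  count i (Outside b p)                  ≡⟨ cong (λ i → count i (Outside b p)) (m+[n∸m]≡n b≤i) ⟨
  count (b + (i ∸ b)) (Outside b p)      ≡⟨ count-+ b (i ∸ b) ⟩
  count b (Outside b p) + count (i ∸ b) (Outside b p ∘ (b +_))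
                                         ≡⟨ cong₂ _+_ (count-Outside-≤ ≤-refl) (count-none inBlock) ⟩
  b + 0                                  ≡⟨ +-identityʳ b ⟩
  b                                      ∎
  where
  open ≡-Reasoning
  inBlock : k < i ∸ b → Outside b p (b + k) ≡ false
  inBlock k<i∸b = Outside-block (m≤m+n b _)
    (+-monoʳ-< b (<-≤-trans k<i∸b (≤-trans (∸-monoˡ-≤ b i≤b+p) (≤-reflexive (m+n∸m≡n b p)))))

count-Outside : b ≤ d → count (d + p) (Outside b p) ≡ d
count-Outside {b} {d} {p} b≤d = begin
  count (d + p) (Outside b p)                ≡⟨ cong (λ n → count n (Outside b p)) d+p≡ ⟩
  count (b + p + (d ∸ b)) (Outside b p)      ≡⟨ count-+ (b + p) (d ∸ b) ⟩
  count (b + p) (Outside b p) + count (d ∸ b) (Outside b p ∘ (b + p +_))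
                                             ≡⟨ cong₂ _+_ (count-Outside-block (m≤m+n b p) ≤-refl)
                                                          (count-all above) ⟩
  b + (d ∸ b)                                ≡⟨ m+[n∸m]≡n b≤d ⟩
  d                                          ∎
  where
  open ≡-Reasoning
  d+p≡ : d + p ≡ b + p + (d ∸ b)
  d+p≡ = trans (cong (_+ p) (sym (m+[n∸m]≡n b≤d))) (sym (xy∙z≈xz∙y b p (d ∸ b)))
  above : k < d ∸ b → Outside b p (b + p + k) ≡ true
  above {k} _ = Outside-≥ {b} {p} (m≤m+n (b + p) k)

Outside-facet : b ≤ d → FC d (d + p) ⟦ Outside b p ⟧
Outside-facet {b} {d} {p} b≤d = prefixCounts⇒FC (count-Outside b≤d) λ _ _ i∉ j∉ →
  subst (2 ∣_) (sym (trans (cong₂ _∸_ (atNonvertex j∉) (atNonvertex i∉)) (n∸n≡0 b))) (2 ∣0)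
  where
  atNonvertex : Outside b p k ≡ false → count k (Outside b p) ≡ b
  atNonvertex k∉ = let b≤k , k<b+p = Outside-false k∉ in count-Outside-block b≤k (<⇒≤ k<b+p)

a<a+2 : a < a + 2
a<a+2 {a} = m<m+n a z<s

Punctured : ℕ → ℕ → ℕ → Bool
Punctured a p = update (Outside (a + 2) p) a false

Shifted : ℕ → ℕ → ℕ → Bool
Shifted a p = update (Punctured a p) (a + 2) true

Outside-adjoins : Adjoins (Outside (a + 2) p) (Punctured a p) a
Outside-adjoins {a} {p} = adjoins-update (Outside-< {b = a + 2} {p} a<a+2)

Shifted-adjoins : 0 < p → Adjoins (Shifted a p) (Punctured a p) (a + 2)
Shifted-adjoins {p} {a} 0<p = update-adjoins
  (trans (update-≢ {P = Outside (a + 2) p} (<⇒≢ a<a+2 ∘ sym)) (Outside-block ≤-refl (m<m+n (a + 2) 0<p)))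

count-Punctured : a + 2 ≤ d → suc (count (d + p) (Punctured a p)) ≡ d
count-Punctured a+2≤d =
  trans (sym (count-adjoin (<-≤-trans a<a+2 (≤-trans a+2≤d (m≤m+n _ _))) Outside-adjoins))
        (count-Outside a+2≤d)

Shifted-false : Shifted a p k ≡ false → k ≡ a ⊎ (a + 2 < k × k < a + 2 + p)
Shifted-false {a} {p} {k} k∉ with k ≟ a + 2
... | yes _    = contradiction k∉ λ ()
... | no k≢a+2 with k ≟ a
...   | yes k≡a = inj₁ k≡a
...   | no _    = let a+2≤k , k<a+2+p = Outside-false k∉ in inj₂ (≤∧≢⇒< a+2≤k (k≢a+2 ∘ sym) , k<a+2+p)

count-Shifted-≤ : count a (Shifted a p) ≡ a
count-Shifted-≤ {a} {p} = count-all λ k<a →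
  trans (update-≢ {P = Punctured a p} (<⇒≢ (<-trans k<a a<a+2)))
        (trans (update-≢ {P = Outside (a + 2) p} (<⇒≢ k<a)) (Outside-< (<-trans k<a a<a+2)))

count-Shifted-block : 0 < p → a + 2 < k → k ≤ a + 2 + p → count k (Shifted a p) ≡ a + 2
count-Shifted-block {p} {a} {k} 0<p a+2<k k≤a+2+p = begin
  count k (Shifted a p)            ≡⟨ count-adjoin a+2<k (Shifted-adjoins 0<p) ⟩
  suc (count k (Punctured a p))    ≡⟨ count-adjoin (<-trans a<a+2 a+2<k) Outside-adjoins ⟨
  count k (Outside (a + 2) p)      ≡⟨ count-Outside-block (<⇒≤ a+2<k) k≤a+2+p ⟩
  a + 2                            ∎
  where open ≡-Reasoning

Shifted-facet : 0 < p → a + 2 < d → FC d (d + p) ⟦ Shifted a p ⟧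
Shifted-facet {p} {a} {d} 0<p a+2<d = prefixCounts⇒FC card even
  where
  card : count (d + p) (Shifted a p) ≡ d
  card = trans (count-adjoin (<-≤-trans a+2<d (m≤m+n d p)) (Shifted-adjoins 0<p)) (count-Punctured (<⇒≤ a+2<d))
  even : i < j → j < d + p → Shifted a p i ≡ false → Shifted a p j ≡ false →
         2 ∣ count j (Shifted a p) ∸ count i (Shifted a p)
  even {i} {j} i<j _ i∉ j∉ with Shifted-false {a} {p} {i} i∉ | Shifted-false {a} {p} {j} j∉
  ... | inj₁ refl         | inj₁ refl         = contradiction i<j (<-irrefl refl)
  ... | inj₂ (a+2<i , _)  | inj₁ refl         = contradiction (<-trans a+2<i i<j) (<-asym a<a+2)
  ... | inj₁ refl         | inj₂ (a+2<j , j<) =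
    subst (2 ∣_) (sym (trans (cong₂ _∸_ (count-Shifted-block 0<p a+2<j (<⇒≤ j<)) (count-Shifted-≤ {a} {p}))
                             (m+n∸m≡n a 2))) ∣-refl
  ... | inj₂ (a+2<i , i<) | inj₂ (a+2<j , j<) =
    subst (2 ∣_) (sym (trans (cong₂ _∸_ (count-Shifted-block 0<p a+2<j (<⇒≤ j<))
                                        (count-Shifted-block 0<p a+2<i (<⇒≤ i<)))
                             (n∸n≡0 (a + 2)))) (2 ∣0)

-- Lower bounds

-- The color of the vertex numbered k; for k ≥ n the value is an arbitrary default.
colorAt : ∀ {n c} → (Fin n → Fin (suc c)) → ℕ → Fin (suc c)
colorAt {n} φ k with k <? n
... | yes k<n = φ (fromℕ< k<n)
... | no  _   = Fin.zero

colorAt-toℕ : ∀ {n c} (φ : Fin n → Fin (suc c)) x → colorAt φ (toℕ x) ≡ φ x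
colorAt-toℕ {n} φ x with toℕ x <? n
... | yes x<n = cong φ (fromℕ<-toℕ x x<n)
... | no  x≮n = contradiction (toℕ<n x) x≮n

UniquelyColored : ∀ {C : Set} → (ℕ → C) → ℕ → (ℕ → Bool) → ℕ → Set
UniquelyColored ψ n e x = x < n × e x ≡ true × (∀ {j} → j < n → e j ≡ true → j ≢ x → ψ j ≢ ψ x)

CF⇒uniquelyColored : ∀ {n c} {H : Hypergraph n} {φ : Fin n → Fin (suc c)} → IsCFColoring H (suc c) φ →
  ∀ e → H ⟦ e ⟧ → k < n → e k ≡ true → ∃ (UniquelyColored (colorAt φ) n e)
CF⇒uniquelyColored {n = n} {φ = φ} cf e He k<n ek≡t
  with cf ⟦ e ⟧ He (fromℕ< k<n , ∈-tabulate⁺ (trans (cong e (toℕ-fromℕ< k<n)) ek≡t))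
... | x , x∈ , unique = toℕ x , toℕ<n x , ∈-tabulate⁻ x∈ , uniqueℕ
  where
  uniqueℕ : ∀ {j} → j < n → e j ≡ true → j ≢ toℕ x → colorAt φ j ≢ colorAt φ (toℕ x)
  uniqueℕ {j} j<n ej≡t j≢x ψj≡ψx = unique (fromℕ< j<n) j∈ (λ { refl → j≢x (sym toℕ-j) }) φj≡φx
    where
    toℕ-j : toℕ (fromℕ< j<n) ≡ j
    toℕ-j = toℕ-fromℕ< j<n
    j∈ : fromℕ< j<n ∈ ⟦ e ⟧
    j∈ = ∈-tabulate⁺ (trans (cong e toℕ-j) ej≡t)
    φj≡φx : φ (fromℕ< j<n) ≡ φ x
    φj≡φx = trans (sym (colorAt-toℕ φ (fromℕ< j<n)))
                  (trans (cong (colorAt φ) toℕ-j) (trans ψj≡ψx (colorAt-toℕ φ x)))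

Fin2-pigeonhole : ∀ {a b c : Fin 2} → a ≢ c → b ≢ c → a ≡ b
Fin2-pigeonhole {Fin.zero}         {Fin.zero}         _   _   = refl
Fin2-pigeonhole {Fin.suc Fin.zero} {Fin.suc Fin.zero} _   _   = refl
Fin2-pigeonhole {Fin.zero}         {Fin.suc Fin.zero} {Fin.zero}         a≢c _   = contradiction refl a≢c
Fin2-pigeonhole {Fin.zero}         {Fin.suc Fin.zero} {Fin.suc Fin.zero} _   b≢c = contradiction refl b≢c
Fin2-pigeonhole {Fin.suc Fin.zero} {Fin.zero}         {Fin.zero}         _   b≢c = contradiction refl b≢c
Fin2-pigeonhole {Fin.suc Fin.zero} {Fin.zero}         {Fin.suc Fin.zero} a≢c _   = contradiction refl a≢c

module _ {ψ : ℕ → Fin 2} where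

  private
    unique-at-adjoined : Adjoins e₁ D u → Adjoins e₂ D v → ψ u ≢ ψ v →
      UniquelyColored ψ n e₁ u → UniquelyColored ψ n e₂ y → j < n → D j ≡ true → j ≢ y → ⊥
    unique-at-adjoined {D = D} {u = u} {v = v} {y = y}
                       adj₁ adj₂ ψu≢ψv (_ , _ , unique₁) (y<n , e₂y , unique₂) j<n Dj j≢y
      with y ≟ v | unique₁ j<n (adjoin-⊇ adj₁ Dj) (adjoin-∉ adj₁ Dj)
    ... | yes refl | ψj≢ψu =
      ψu≢ψv (Fin2-pigeonhole (≢-sym ψj≢ψu) (≢-sym (unique₂ j<n (adjoin-⊇ adj₂ Dj) j≢y)))
    ... | no y≢v   | ψj≢ψu = unique₂ j<n (adjoin-⊇ adj₂ Dj) j≢y (Fin2-pigeonhole ψj≢ψu ψy≢ψu)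
      where
      Dy : D y ≡ true
      Dy = adjoin-⊆ adj₂ e₂y y≢v
      ψy≢ψu : ψ y ≢ ψ u
      ψy≢ψu = unique₁ y<n (adjoin-⊇ adj₁ Dy) (adjoin-∉ adj₁ Dy)

    same-color-off-unique : UniquelyColored ψ n e x → Adjoins e D u → u < n → u ≢ x →
      j < n → D j ≡ true → j ≢ x → ψ u ≡ ψ j
    same-color-off-unique (_ , _ , unique) adj u<n u≢x j<n Dj j≢x =
      Fin2-pigeonhole (unique u<n (proj₁ (proj₂ adj)) u≢x) (unique j<n (adjoin-⊇ adj Dj) j≢x)

  adjoin-pair : Adjoins e₁ D u → Adjoins e₂ D v → u < n → v < n → ψ u ≢ ψ v →
    UniquelyColored ψ n e₁ x → UniquelyColored ψ n e₂ y →
    ∀ {j} → j < n → D j ≡ true → j ≡ x ⊎ j ≡ y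
  adjoin-pair {u = u} {v = v} {x = x} {y = y} adj₁ adj₂ u<n v<n ψu≢ψv U₁ U₂ {j} j<n Dj
    with j ≟ x | j ≟ y
  ... | yes j≡x | _       = inj₁ j≡x
  ... | no _    | yes j≡y = inj₂ j≡y
  ... | no j≢x  | no j≢y  with u ≟ x | v ≟ y
  ...   | yes refl | _        = ⊥-elim (unique-at-adjoined adj₁ adj₂ ψu≢ψv U₁ U₂ j<n Dj j≢y)
  ...   | _        | yes refl = ⊥-elim (unique-at-adjoined adj₂ adj₁ (≢-sym ψu≢ψv) U₂ U₁ j<n Dj j≢x)
  ...   | no u≢x   | no v≢y   = ⊥-elim (ψu≢ψv (trans (same-color-off-unique U₁ adj₁ u<n u≢x j<n Dj j≢x)
                                                  (sym (same-color-off-unique U₂ adj₂ v<n v≢y j<n Dj j≢y))))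

module _ {d p c : ℕ} {φ : Fin (d + p) → Fin (suc c)} (cf : IsCFColoring (FC d (d + p)) (suc c) φ) where

  initial-facet-unique : 0 < d → ∃ λ x → x < d × (∀ {y} → y < d → y ≢ x → colorAt φ y ≢ colorAt φ x)
  initial-facet-unique 0<d
    with CF⇒uniquelyColored cf (Outside d p) (Outside-facet ≤-refl) (<-≤-trans 0<d (m≤m+n d p)) (Outside-< 0<d)
  ... | x , x<n , x∈ , unique =
    x , Outside-true x∈ x<n , λ y<d → unique (<-≤-trans y<d (m≤m+n d p)) (Outside-< y<d)

Fin1-≡ : (a b : Fin 1) → a ≡ b
Fin1-≡ Fin.zero Fin.zero = refl

no-CF-1-coloring : 2 ≤ d → (φ : Fin (d + p) → Fin 1) → ¬ IsCFColoring (FC d (d + p)) 1 φ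
no-CF-1-coloring 2≤d φ cf with initial-facet-unique cf (<-trans z<s 2≤d)
... | x , _ , unique with x ≟ 0
...   | yes refl = unique 2≤d (λ ()) (Fin1-≡ _ _)
...   | no  x≢0  = unique (<-trans z<s 2≤d) (x≢0 ∘ sym) (Fin1-≡ _ _)

module _ {d p : ℕ} {φ : Fin (d + p) → Fin 2} (cf : IsCFColoring (FC d (d + p)) 2 φ) where

  private
    ψ : ℕ → Fin 2
    ψ = colorAt φ

  CF⇒period-2 : 4 ≤ d → 0 < p → a + 2 < d → ψ a ≡ ψ (a + 2)
  CF⇒period-2 {a} 4≤d 0<p a+2<d = decidable-stable (ψ a ≟ᶠ ψ (a + 2)) λ ψa≢ψa+2 →
    let x , U₁ = CF⇒uniquelyColored cf (Outside (a + 2) p) (Outside-facet (<⇒≤ a+2<d)) (≤-<-trans z≤n a<n)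
                   (Outside-< {b = a + 2} {p} (≤-<-trans z≤n a<a+2))
        y , U₂ = CF⇒uniquelyColored cf (Shifted a p) (Shifted-facet 0<p a+2<d) a+2<n (proj₁ (proj₂ adjoined))
        D⊆xy   = adjoin-pair Outside-adjoins adjoined a<n a+2<n ψa≢ψa+2 U₁ U₂
    in  ≤⇒≯ (count-pair (proj₁ U₁) (proj₁ U₂) D⊆xy)
            (s≤s⁻¹ (subst (4 ≤_) (sym (count-Punctured (<⇒≤ a+2<d))) 4≤d))
    where
    a+2<n : a + 2 < d + p
    a+2<n = <-≤-trans a+2<d (m≤m+n d p)
    a<n : a < d + p
    a<n = <-trans a<a+2 a+2<n
    adjoined : Adjoins (Shifted a p) (Punctured a p) (a + 2)
    adjoined = Shifted-adjoins 0<p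

  ¬period-2 : 4 ≤ d → ¬ (∀ {a} → a + 2 < d → ψ a ≡ ψ (a + 2))
  ¬period-2 4≤d period with initial-facet-unique cf (<-≤-trans z<s 4≤d)
  ... | x , x<d , unique with x + 2 <? d
  ...   | yes x+2<d = unique x+2<d (<⇒≢ a<a+2 ∘ sym) (sym (period x+2<d))
  ...   | no  x+2≮d = unique (<-trans x-2<x x<d) (<⇒≢ x-2<x) (trans (period x-2+2<d) (cong ψ x-2+2≡x))
    where
    x-2+2≡x : x ∸ 2 + 2 ≡ x
    x-2+2≡x = m∸n+n≡m (+-cancelʳ-≤ 2 2 x (≤-trans 4≤d (≮⇒≥ x+2≮d)))
    x-2<x : x ∸ 2 < x
    x-2<x = subst (x ∸ 2 <_) x-2+2≡x a<a+2
    x-2+2<d : x ∸ 2 + 2 < d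
    x-2+2<d = subst (_< d) (sym x-2+2≡x) x<d

no-CF-2-coloring : 4 ≤ d → 0 < p → (φ : Fin (d + p) → Fin 2) → ¬ IsCFColoring (FC d (d + p)) 2 φ
no-CF-2-coloring 4≤d 0<p φ cf = ¬period-2 cf 4≤d (CF⇒period-2 cf 4≤d 0<p)

fewer-than-2-colors : 2 ≤ d → ∀ c → c < 2 → ¬ ∃ (IsCFColoring (FC d (d + p)) c)
fewer-than-2-colors {d} {p} 2≤d 0 _ (φ , _) with φ (fromℕ< (<-≤-trans (<-trans z<s 2≤d) (m≤m+n d p)))
... | ()
fewer-than-2-colors 2≤d 1 _ (φ , cf) = no-CF-1-coloring 2≤d φ cf
fewer-than-2-colors _ (suc (suc _)) (s≤s (s≤s ()))

fewer-than-3-colors : 4 ≤ d → 0 < p → ∀ c → c < 3 → ¬ ∃ (IsCFColoring (FC d (d + p)) c)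
fewer-than-3-colors 4≤d 0<p 2 _ (φ , cf) = no-CF-2-coloring 4≤d 0<p φ cf
fewer-than-3-colors 4≤d _   0 _ = fewer-than-2-colors (≤-trans (s≤s (s≤s z≤n)) 4≤d) 0 z<s
fewer-than-3-colors 4≤d _   1 _ = fewer-than-2-colors (≤-trans (s≤s (s≤s z≤n)) 4≤d) 1 (s<s z<s)
fewer-than-3-colors _   _   (suc (suc (suc _))) (s≤s (s≤s (s≤s ())))

-- Upper bounds

first last : ∀ {m} → Fin (suc (suc m))
first    = Fin.zero
last {m} = fromℕ (suc m)

∈-between-ends : ∀ {m} {x : Fin (suc (suc m))} → x ≢ first → x ≢ last → x ∈ between first last
∈-between-ends {m} {x} x≢first x≢last =
  ∈-tabulate⁺ {f = λ k → Between 0 (toℕ (last {m})) (toℕ k)} (cong₂ _∧_ first<x x<last)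
  where
  first<x : ⌊ 0 <? toℕ x ⌋ ≡ true
  first<x = ⌊⌋-true (0 <? toℕ x) (n≢0⇒n>0 (x≢first ∘ toℕ-injective))
  toℕ-last : toℕ (last {m}) ≡ suc m
  toℕ-last = toℕ-fromℕ (suc m)
  x<last : ⌊ toℕ x <? toℕ (last {m}) ⌋ ≡ true
  x<last = ⌊⌋-true (toℕ x <? toℕ (last {m})) (subst (toℕ x <_) (sym toℕ-last)
             (≤∧≢⇒< (s≤s⁻¹ (toℕ<n x)) λ x≡ → x≢last (toℕ-injective (trans x≡ (sym toℕ-last)))))

facet-meets-end : ∀ {d m} {S : Subset (suc (suc m))} → ¬ 2 ∣ d → FC d (suc (suc m)) S → first ∈ S ⊎ last ∈ S
facet-meets-end {S = S} odd (card , gale) with first ∈? S | last ∈? S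
... | yes first∈ | _         = inj₁ first∈
... | no _       | yes last∈ = inj₂ last∈
... | no first∉  | no last∉  =
  contradiction (subst (2 ∣_) (trans (cong ∣_∣ S∩between≡S) card) (gale first last first∉ last∉)) odd
  where
  S∩between≡S : S ∩ between first last ≡ S
  S∩between≡S = ⊆-antisym (p∩q⊆p S _) λ x∈S →
    x∈p∩q⁺ (x∈S , ∈-between-ends (λ { refl → first∉ x∈S }) (λ { refl → last∉ x∈S }))

endColoring : ∀ {m} → Fin (suc (suc m)) → Fin 3
endColoring x with x ≟ᶠ first | x ≟ᶠ last
... | yes _ | _     = # 0
... | no _  | yes _ = # 1
... | no _  | no _  = # 2

endColoring≡0 : ∀ {m} {x : Fin (suc (suc m))} → endColoring x ≡ # 0 → x ≡ first
endColoring≡0 {x = x} eq with x ≟ᶠ first | x ≟ᶠ last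
... | yes x≡first | _     = x≡first
... | no _        | yes _ = contradiction eq λ ()
... | no _        | no _  = contradiction eq λ ()

endColoring≡1 : ∀ {m} {x : Fin (suc (suc m))} → endColoring x ≡ # 1 → x ≡ last
endColoring≡1 {x = x} eq with x ≟ᶠ first | x ≟ᶠ last
... | yes _ | _          = contradiction eq λ ()
... | no _  | yes x≡last = x≡last
... | no _  | no _       = contradiction eq λ ()

endColoring-last : ∀ {m} → endColoring (last {m}) ≡ # 1
endColoring-last {m} with last {m} ≟ᶠ last
... | yes _        = refl
... | no last≢last = contradiction refl last≢last

endColoring-interior : ∀ {m} {x : Fin (suc (suc m))} → x ≢ first → x ≢ last → endColoring x ≡ # 2
endColoring-interior {x = x} x≢first x≢last with x ≟ᶠ first | x ≟ᶠ last
... | yes x≡first | _          = contradiction x≡first x≢first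
... | no _        | yes x≡last = contradiction x≡last x≢last
... | no _        | no _       = refl

endColoring-CF : ∀ {d m} → ¬ 2 ∣ d → IsCFColoring (FC d (suc (suc m))) 3 endColoring
endColoring-CF {m = m} odd S facet _ with facet-meets-end odd facet
... | inj₁ first∈ = first , first∈ , λ _ _ y≢first → y≢first ∘ endColoring≡0
... | inj₂ last∈  = last , last∈ , λ _ _ y≢last eq → y≢last (endColoring≡1 (trans eq (endColoring-last {m})))

mergeEnds : Fin 3 → Fin 2
mergeEnds Fin.zero                     = # 0
mergeEnds (Fin.suc Fin.zero)           = # 0
mergeEnds (Fin.suc (Fin.suc Fin.zero)) = # 1

mergeEnds≡0 : ∀ {m} {x : Fin (suc (suc m))} → mergeEnds (endColoring x) ≡ # 0 → x ≡ first ⊎ x ≡ last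
mergeEnds≡0 {x = x} eq with endColoring x in c≡
... | Fin.zero                   = inj₁ (endColoring≡0 c≡)
... | Fin.suc Fin.zero           = inj₂ (endColoring≡1 c≡)
... | Fin.suc (Fin.suc Fin.zero) = contradiction eq λ ()

mergeEnds≡1 : ∀ {m} {x : Fin (suc (suc m))} → mergeEnds (endColoring x) ≡ # 1 → x ≢ first × x ≢ last
mergeEnds≡1 {m} eq = (λ { refl → contradiction eq λ () })
                   , (λ { refl → contradiction (trans (sym eq) (cong mergeEnds (endColoring-last {m}))) λ () })

∣p∪q∣≤∣p∣+∣q∣ : ∀ {n} (p q : Subset n) → ∣ p ∪ q ∣ ≤ ∣ p ∣ + ∣ q ∣
∣p∪q∣≤∣p∣+∣q∣ []            []            = z≤n
∣p∪q∣≤∣p∣+∣q∣ (outside ∷ p) (outside ∷ q) = ∣p∪q∣≤∣p∣+∣q∣ p q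
∣p∪q∣≤∣p∣+∣q∣ (outside ∷ p) (inside  ∷ q) =
  subst (suc ∣ p ∪ q ∣ ≤_) (sym (+-suc ∣ p ∣ ∣ q ∣)) (s≤s (∣p∪q∣≤∣p∣+∣q∣ p q))
∣p∪q∣≤∣p∣+∣q∣ (inside  ∷ p) (outside ∷ q) = s≤s (∣p∪q∣≤∣p∣+∣q∣ p q)
∣p∪q∣≤∣p∣+∣q∣ (inside  ∷ p) (inside  ∷ q) =
  s≤s (≤-trans (∣p∪q∣≤∣p∣+∣q∣ p q) (+-monoʳ-≤ ∣ p ∣ (n≤1+n ∣ q ∣)))

⊆⁅x⁆∪⁅y⁆⇒∣p∣≤2 : ∀ {n} {p : Subset n} {x y} → p ⊆ ⁅ x ⁆ ∪ ⁅ y ⁆ → ∣ p ∣ ≤ 2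
⊆⁅x⁆∪⁅y⁆⇒∣p∣≤2 {p = p} {x} {y} p⊆ = begin
  ∣ p ∣                   ≤⟨ p⊆q⇒∣p∣≤∣q∣ p⊆ ⟩
  ∣ ⁅ x ⁆ ∪ ⁅ y ⁆ ∣       ≤⟨ ∣p∪q∣≤∣p∣+∣q∣ ⁅ x ⁆ ⁅ y ⁆ ⟩
  ∣ ⁅ x ⁆ ∣ + ∣ ⁅ y ⁆ ∣   ≡⟨ cong₂ _+_ (∣⁅x⁆∣≡1 x) (∣⁅x⁆∣≡1 y) ⟩
  2                       ∎
  where open ≤-Reasoning

∈-removals⇒4≤∣p∣ : ∀ {n} {p : Subset n} {w x y z} →
                   w ∈ p → x ∈ p - w → y ∈ p - w - x → z ∈ p - w - x - y → 4 ≤ ∣ p ∣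
∈-removals⇒4≤∣p∣ w∈ x∈ y∈ z∈ =
  ≤-trans (s≤s (≤-trans (s≤s (≤-trans (s≤s (≤-trans (s≤s z≤n) (x∈p⇒∣p-x∣<∣p∣ z∈)))
                                      (x∈p⇒∣p-x∣<∣p∣ y∈)))
                        (x∈p⇒∣p-x∣<∣p∣ x∈)))
          (x∈p⇒∣p-x∣<∣p∣ w∈)

both-ends⇒unique-interior : ∀ {m} {S : Subset (suc (suc m))} → ∣ S ∣ ≡ 3 → first ∈ S → last ∈ S →
  ∃ λ k → k ∈ S × k ≢ first × k ≢ last × (∀ {x} → x ∈ S → x ≢ first → x ≢ last → x ≡ k)
both-ends⇒unique-interior {m} {S} card first∈ last∈
  with any? (λ x → x ∈? S ×-dec ¬? (x ≟ᶠ first) ×-dec ¬? (x ≟ᶠ last))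
... | yes (k , k∈ , k≢first , k≢last) = k , k∈ , k≢first , k≢last , unique
  where
  unique : ∀ {x} → x ∈ S → x ≢ first → x ≢ last → x ≡ k
  unique {x} x∈ x≢first x≢last with x ≟ᶠ k
  ... | yes x≡k = x≡k
  ... | no  x≢k =
    contradiction (≤-trans (∈-removals⇒4≤∣p∣ first∈ last∈′ k∈′ x∈′) (≤-reflexive card)) (<-irrefl refl)
    where
    last∈′ : last ∈ S - first
    last∈′ = x∈p∧x≢y⇒x∈p-y {y = first} last∈ λ ()
    k∈′ : k ∈ S - first - last
    k∈′ = x∈p∧x≢y⇒x∈p-y (x∈p∧x≢y⇒x∈p-y k∈ k≢first) k≢last
    x∈′ : x ∈ S - first - last - k
    x∈′ = x∈p∧x≢y⇒x∈p-y (x∈p∧x≢y⇒x∈p-y (x∈p∧x≢y⇒x∈p-y x∈ x≢first) x≢last) x≢k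
... | no ¬interior =
  contradiction (≤-trans (≤-reflexive (sym card)) (⊆⁅x⁆∪⁅y⁆⇒∣p∣≤2 {x = first} {last} S⊆ends)) (<-irrefl refl)
  where
  S⊆ends : S ⊆ ⁅ first ⁆ ∪ ⁅ last ⁆
  S⊆ends {x} x∈ with x ≟ᶠ first | x ≟ᶠ last
  ... | yes refl   | _         = x∈p∪q⁺ {q = ⁅ last ⁆} (inj₁ (x∈⁅x⁆ first))
  ... | no _       | yes refl  = x∈p∪q⁺ {p = ⁅ first ⁆} (inj₂ (x∈⁅x⁆ last))
  ... | no x≢first | no x≢last = contradiction (x , x∈ , x≢first , x≢last) ¬interior

mergeEnds-CF : ∀ {m} → IsCFColoring (FC 3 (suc (suc m))) 2 (mergeEnds ∘ endColoring)
mergeEnds-CF {m} S facet@(card , _) _ with first {m} ∈? S | last {m} ∈? S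
... | yes first∈ | no last∉  = first , first∈ , λ y y∈ y≢first eq →
  [ y≢first , (λ { refl → last∉ y∈ }) ]′ (mergeEnds≡0 eq)
... | no first∉  | yes last∈ = last , last∈ , λ y y∈ y≢last eq →
  [ (λ { refl → first∉ y∈ }) , y≢last ]′ (mergeEnds≡0 (trans eq (cong mergeEnds (endColoring-last {m}))))
... | no first∉  | no last∉  = ⊥-elim ([ first∉ , last∉ ]′ (facet-meets-end (from-no (2 ∣? 3)) facet))
... | yes first∈ | yes last∈ =
  let k , k∈ , k≢first , k≢last , unique = both-ends⇒unique-interior card first∈ last∈
  in  k , k∈ , λ y y∈ y≢k eq →
        let y≢first , y≢last = mergeEnds≡1 (trans eq (cong mergeEnds (endColoring-interior k≢first k≢last)))
        in  y≢k (unique y∈ y≢first y≢last)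

above-dimension : (Q : ℕ → Set) → d < n → (∀ {p} → 0 < p → Q (d + p)) → Q n
above-dimension Q d<n Q[d+p] = subst Q (m+[n∸m]≡n (<⇒≤ d<n)) (Q[d+p] (m<n⇒0<n∸m d<n))

χCF-FC3 : 3 < n → χCF≡ (FC 3 n) 2
χCF-FC3 {suc zero} (s≤s ())
χCF-FC3 {suc (suc m)} 3<n = (mergeEnds ∘ endColoring , mergeEnds-CF) , λ c c<2 →
  above-dimension (λ n → ¬ ∃ (IsCFColoring (FC 3 n) c)) 3<n λ _ → fewer-than-2-colors (s≤s (s≤s z≤n)) c c<2

χCF-FC-odd : ¬ 2 ∣ d → 4 ≤ d → d < n → χCF≡ (FC d n) 3
χCF-FC-odd {d} {suc (suc m)} odd 4≤d d<n = (endColoring , endColoring-CF odd) , λ c c<3 →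
  above-dimension (λ n → ¬ ∃ (IsCFColoring (FC d n) c)) d<n λ 0<p → fewer-than-3-colors 4≤d 0<p c c<3
χCF-FC-odd {n = 1} _ () (s≤s z≤n)

proposition2p2 :
    (∀ (n : ℕ) → 4 ≤ n → χCF≡ (FC 3 n) 2) ×
    (∀ (d n : ℕ) → ¬ (2 ∣ d) → 5 ≤ d → d + 1 ≤ n → χCF≡ (FC d n) 3)
proposition2p2 =
  (λ _ → χCF-FC3) ,
  λ d n odd 5≤d d+1≤n → χCF-FC-odd odd (≤-trans (n≤1+n 4) 5≤d) (subst (_≤ n) (+-comm d 1) d+1≤n)
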